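{- Let $k\ge 1$, let $\mathcal{F}\subseteq\binom{[n]}{k}$ with $\bigcap_{A\in \mathcal{F}}A=\varnothing$, and for $0\le t\le k$ let $\mathcal{G}_t:=\{A\in \mathcal{F}:i_{\mathcal{F}}(A)\ge t\}$. Then \[ \Phi_{n,k}(\mathcal{F}) = \frac{|\mathcal{F}|}{\binom{n}{k}}+ \sum_{t=1}^{k-1}\frac{n-k}{n-t+1}\cdot \frac{|\mathcal{G}_t|}{\binom{n-t}{k-t}}. \] In particular, \[ \Phi_{n,k}(\mathcal{F}) \le \frac{|\mathcal{F}|}{\binom{n}{k}}+ \sum_{t=1}^{k-1}\frac{|\mathcal{G}_t|}{\binom{n-t}{k-t}}. \]
   Context: $\binom{[n]}{k}$ denotes the family of all $k$-element subsets of $[n]$. For $A\in\mathcal{F}$, $i_{\mathcal{F}}(A):=\min_{B\in\mathcal{F}}|A\cap B|$, and $\Phi_{n,k}(\mathcal{F}):=\sum_{A\in \mathcal{F}}\binom{n-i_{\mathcal{F}}(A)}{k-i_{\mathcal{F}}(A)}^{ -1}$. -}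

module Defs where

open import Data.Nat using (ℕ; zero; suc; _∸_; _⊓_; _≤?_)
open import Data.Nat.Combinatorics using (_C_)
open import Data.Integer using (+_)
open import Data.Rational using (ℚ; 0ℚ; _+_; _/_)
open import Data.List using (List; []; _∷_; foldr; map; filter; length)
open import Data.Fin.Subset using (Subset; _∩_; ∣_∣)

-- Rational number a/b for natural numbers; conventionally 0 when b = 0
-- (only ever used with b > 0 in the statement whenever it matters).
frac : ℕ → ℕ → ℚ
frac a zero    = 0ℚ
frac a (suc d) = (+ a) / suc d

∑ : List ℚ → ℚ
∑ = foldr _+_ 0ℚ

range : ℕ → ℕ → List ℕ
range a b = go (suc b ∸ a) a
  where
  go : ℕ → ℕ → List ℕ
  go zero    x = []
  go (suc m) x = x ∷ go m (suc x)

-- i_F(A) = min_{B ∈ F} |A ∩ B|.  (For F = [] the value is irrelevant; we return n.)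
iF : {n : ℕ} → List (Subset n) → Subset n → ℕ
iF {n} []      A = n
iF {n} (B ∷ []) A = ∣ A ∩ B ∣
iF {n} (B ∷ B' ∷ Bs) A = ∣ A ∩ B ∣ ⊓ iF (B' ∷ Bs) A

Φ : (n k : ℕ) → List (Subset n) → ℚ
Φ n k F = ∑ (map (λ A → frac 1 ((n ∸ iF F A) C (k ∸ iF F A))) F)

G : {n : ℕ} → List (Subset n) → ℕ → List (Subset n)
G F t = filter (λ A → t ≤? iF F A) F

{-# OPTIONS --safe #-}
-- Absorption, (n-t+1)·C(n-t,k-t) = (k-t+1)·C(n-t+1,k-t+1), makes the reciprocals telescope:
--   1/C(n-t,k-t) = 1/C(n-t+1,k-t+1) + (n-k)/(n-t+1) · 1/C(n-t,k-t),
-- hence 1/C(n-i,k-i) = 1/C(n,k) + Σ_{1≤t≤i} (n-k)/(n-t+1) · 1/C(n-t,k-t).  Take i = i_F(A) and sum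
-- over A ∈ F: exchanging the two sums, level t is counted once for each A with i_F(A) ≥ t, i.e.
-- |G_t| times.  Since the members of F have no common point, every i_F(A) is below k, so only the
-- levels t ≤ k-1 occur.  The inequality then follows from (n-k)/(n-t+1) ≤ 1.
module Submission where

open import Algebra.Bundles using (module CommutativeMonoid)
open import Data.Bool using (true; false; if_then_else_)
open import Data.Fin using (Fin)
open import Data.Fin.Subset using (Subset; ∣_∣; _∩_; Nonempty) renaming (_∈_ to _∈ₛ_; _∉_ to _∉ₛ_)
open import Data.Fin.Subset.Properties using (∣p∣≤n; p∩q⊆p; x∈p∩q⁻; p⊂q⇒∣p∣<∣q∣; nonempty?; Empty-unique; ∣⊥∣≡0)
open import Data.Integer as ℤ using (+_)
import Data.Integer.Properties as ℤ
open import Data.List using (List; []; _∷_; _++_; [_]; _∷ʳ_; map; filter; length; applyUpTo)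
import Data.List.Properties as List
open import Data.List.Membership.Propositional using (_∈_)
open import Data.List.Relation.Unary.All as All using (All)
import Data.List.Relation.Unary.All.Properties as All
open import Data.List.Relation.Unary.Any using (here; there)
open import Data.List.Relation.Unary.Unique.Propositional using (Unique)
open import Data.Nat as ℕ using (ℕ; zero; suc; _+_; _*_; _∸_; _≤_; _<_; _≥_; _≤?_; s≤s; z≤n)
open import Data.Nat.Combinatorics using (_C_; nC1≡n; nCk+nC[k+1]≡[n+1]C[k+1])
import Data.Nat.Properties as ℕ
open import Data.Nat.Tactic.RingSolver using (solve-∀)
open import Data.Product using (_×_; _,_; proj₂; ∃)
open import Data.Rational as ℚ using (ℚ; 0ℚ; 1ℚ; toℚᵘ; NonNegative)
  renaming (_+_ to _+ℚ_; _*_ to _*ℚ_; _≤_ to _≤ℚ_)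
import Data.Rational.Properties as ℚ
open import Data.Rational.Unnormalised as ℚᵘ using (mkℚᵘ; *≡*; *≤*) renaming (_≃_ to _≃ᵘ_)
import Data.Rational.Unnormalised.Properties as ℚᵘ
open import Data.Sum using (inj₁; inj₂)
open import Function using (_∘_)
open import Relation.Binary.PropositionalEquality hiding ([_])
open import Relation.Nullary using (Dec; does; yes; no; contradiction)
open import Relation.Unary using (Pred; Decidable)

open import Algebra.Properties.CommutativeSemigroup (CommutativeMonoid.commutativeSemigroup ℚ.+-0-commutativeMonoid)
  using (interchange)

open import Defs

toℚᵘ-frac : ∀ a d → toℚᵘ (frac a (suc d)) ≃ᵘ mkℚᵘ (+ a) d
toℚᵘ-frac a d = ℚ.toℚᵘ-fromℚᵘ (mkℚᵘ (+ a) d)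

≃ᵘ⇒≡frac : ∀ {p a d} → toℚᵘ p ≃ᵘ mkℚᵘ (+ a) d → p ≡ frac a (suc d)
≃ᵘ⇒≡frac {a = a} {d} p≃ = ℚ.toℚᵘ-injective (ℚᵘ.≃-trans p≃ (ℚᵘ.≃-sym (toℚᵘ-frac a d)))

frac-cross : ∀ a b x y → a * suc y ≡ b * suc x → frac a (suc x) ≡ frac b (suc y)
frac-cross a b x y eq = ℚ.fromℚᵘ-cong {mkℚᵘ (+ a) x} {mkℚᵘ (+ b) y} (*≡* (begin
  + a ℤ.* + suc y ≡⟨ ℤ.pos-* a (suc y) ⟨
  + (a * suc y)   ≡⟨ cong +_ eq ⟩
  + (b * suc x)   ≡⟨ ℤ.pos-* b (suc x) ⟩
  + b ℤ.* + suc x ∎))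
  where open ≡-Reasoning

frac-+ : ∀ a b x y → frac a (suc x) +ℚ frac b (suc y) ≡ frac (a * suc y + b * suc x) (suc x * suc y)
frac-+ a b x y = ≃ᵘ⇒≡frac (begin
  toℚᵘ (frac a (suc x) +ℚ frac b (suc y))           ≈⟨ ℚ.toℚᵘ-homo-+ (frac a (suc x)) (frac b (suc y)) ⟩
  toℚᵘ (frac a (suc x)) ℚᵘ.+ toℚᵘ (frac b (suc y)) ≈⟨ ℚᵘ.+-cong (toℚᵘ-frac a x) (toℚᵘ-frac b y) ⟩
  mkℚᵘ (+ a ℤ.* + suc y ℤ.+ + b ℤ.* + suc x) _      ≡⟨ cong (λ z → mkℚᵘ z _) ℤ-cast ⟨
  mkℚᵘ (+ (a * suc y + b * suc x)) _                ∎)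
  where
  open ℚᵘ.≃-Reasoning
  ℤ-cast : + (a * suc y + b * suc x) ≡ + a ℤ.* + suc y ℤ.+ + b ℤ.* + suc x
  ℤ-cast = trans (ℤ.pos-+ (a * suc y) (b * suc x)) (cong₂ ℤ._+_ (ℤ.pos-* a (suc y)) (ℤ.pos-* b (suc x)))

frac-* : ∀ a b x y → frac a (suc x) *ℚ frac b (suc y) ≡ frac (a * b) (suc x * suc y)
frac-* a b x y = ≃ᵘ⇒≡frac (begin
  toℚᵘ (frac a (suc x) *ℚ frac b (suc y))           ≈⟨ ℚ.toℚᵘ-homo-* (frac a (suc x)) (frac b (suc y)) ⟩
  toℚᵘ (frac a (suc x)) ℚᵘ.* toℚᵘ (frac b (suc y)) ≈⟨ ℚᵘ.*-cong (toℚᵘ-frac a x) (toℚᵘ-frac b y) ⟩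
  mkℚᵘ (+ a ℤ.* + b) _                              ≡⟨ cong (λ z → mkℚᵘ z _) (ℤ.pos-* a b) ⟨
  mkℚᵘ (+ (a * b)) _                                ∎)
  where open ℚᵘ.≃-Reasoning

frac-mono-≤ : ∀ a b x y → a * suc y ≤ b * suc x → frac a (suc x) ≤ℚ frac b (suc y)
frac-mono-≤ a b x y le = ℚ.toℚᵘ-cancel-≤ (begin
  toℚᵘ (frac a (suc x)) ≃⟨ toℚᵘ-frac a x ⟩
  mkℚᵘ (+ a) x          ≤⟨ *≤* (subst₂ ℤ._≤_ (ℤ.pos-* a (suc y)) (ℤ.pos-* b (suc x)) (ℤ.+≤+ le)) ⟩
  mkℚᵘ (+ b) y          ≃⟨ toℚᵘ-frac b y ⟨
  toℚᵘ (frac b (suc y)) ∎)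
  where open ℚᵘ.≤-Reasoning

frac-nonNeg : ∀ a d → NonNegative (frac a d)
frac-nonNeg a zero    = _
frac-nonNeg a (suc d) = ℚ.normalize-nonNeg a (suc d)

frac≤1 : ∀ {a d} → a ≤ d → frac a d ≤ℚ 1ℚ
frac≤1 {d = zero}  _   = ℚ.nonNegative⁻¹ 1ℚ
frac≤1 {a} {suc d} a≤d = frac-mono-≤ a 1 d 0 (subst₂ _≤_ (sym (ℕ.*-identityʳ a)) (sym (ℕ.*-identityˡ (suc d))) a≤d)

frac-zero : ∀ d → frac 0 d ≡ 0ℚ
frac-zero zero    = refl
frac-zero (suc d) = frac-cross 0 0 d 0 refl

frac-suc : ∀ a d → frac (suc a) d ≡ frac 1 d +ℚ frac a d
frac-suc a zero    = sym (ℚ.+-identityʳ 0ℚ)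
frac-suc a (suc d) = trans (frac-cross (suc a) (1 * suc d + a * suc d) d (d + d * suc d) (cross a d)) (sym (frac-+ 1 a d d))
  where
  cross : ∀ a d → suc a * suc (d + d * suc d) ≡ (1 * suc d + a * suc d) * suc d
  cross = solve-∀

k≤n⇒nCk>0 : ∀ {n k} → k ≤ n → 0 < n C k
k≤n⇒nCk>0 {k = zero}  _         = s≤s z≤n
k≤n⇒nCk>0 {suc n} {suc k} (s≤s k≤n) =
  subst (0 <_) (nCk+nC[k+1]≡[n+1]C[k+1] n k) (ℕ.≤-trans (k≤n⇒nCk>0 k≤n) (ℕ.m≤m+n _ _))

[1+n]*nCk≡[1+k]*[1+n]C[1+k] : ∀ n k → suc n * (n C k) ≡ suc k * (suc n C suc k)
[1+n]*nCk≡[1+k]*[1+n]C[1+k] zero    zero    = refl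
[1+n]*nCk≡[1+k]*[1+n]C[1+k] zero    (suc k) = sym (ℕ.*-zeroʳ (suc (suc k)))
[1+n]*nCk≡[1+k]*[1+n]C[1+k] (suc n) zero    =
  trans (ℕ.*-identityʳ (suc (suc n))) (sym (trans (ℕ.*-identityˡ _) (nC1≡n (suc (suc n)))))
[1+n]*nCk≡[1+k]*[1+n]C[1+k] (suc n) (suc k) = begin
  suc (suc n) * P                                ≡⟨ cong (λ z → P + suc n * z) (nCk+nC[k+1]≡[n+1]C[k+1] n k) ⟨
  P + suc n * (n C k + n C suc k)                ≡⟨ cong (λ z → P + z) (ℕ.*-distribˡ-+ (suc n) (n C k) (n C suc k)) ⟩
  P + (suc n * (n C k) + suc n * (n C suc k))    ≡⟨ cong₂ (λ u v → P + (u + v)) ([1+n]*nCk≡[1+k]*[1+n]C[1+k] n k)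
                                                                              ([1+n]*nCk≡[1+k]*[1+n]C[1+k] n (suc k)) ⟩
  P + (suc k * P + suc (suc k) * S)              ≡⟨ regroup P S k ⟩
  suc (suc k) * (P + S)                          ≡⟨ cong (suc (suc k) *_) (nCk+nC[k+1]≡[n+1]C[k+1] (suc n) (suc k)) ⟩
  suc (suc k) * (suc (suc n) C suc (suc k))      ∎
  where
  open ≡-Reasoning
  P S : ℕ
  P = suc n C suc k
  S = suc n C suc (suc k)
  regroup : ∀ p s k → p + (suc k * p + suc (suc k) * s) ≡ suc (suc k) * (p + s)
  regroup = solve-∀

1/C : ℕ → ℕ → ℚ
1/C n k = frac 1 (n C k)

reciprocal-split : ∀ b d X Y → 0 < X → 0 < Y → suc (b + d) * X ≡ suc b * Y →
                   frac 1 X ≡ frac 1 Y +ℚ frac d (suc (b + d)) *ℚ frac 1 X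
reciprocal-split b d (suc x) (suc y) _ _ [1+b+d]X≡[1+b]Y = sym (begin
  frac 1 Y +ℚ frac d A *ℚ frac 1 X                 ≡⟨ cong (frac 1 Y +ℚ_) (frac-* d 1 (b + d) x) ⟩
  frac 1 Y +ℚ frac (d * 1) (A * X)                 ≡⟨ frac-+ 1 (d * 1) y x′ ⟩
  frac (1 * (A * X) + d * 1 * Y) (Y * (A * X))     ≡⟨ frac-cross (1 * (A * X) + d * 1 * Y) 1 (x′ + y * suc x′) x cross ⟩
  frac 1 X                                         ∎)
  where
  open ≡-Reasoning
  X Y A x′ : ℕ
  X = suc x
  Y = suc y
  A = suc (b + d)
  x′ = x + (b + d) * X
  cross : (1 * (A * X) + d * 1 * Y) * X ≡ 1 * (Y * (A * X))
  cross = begin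
    (1 * (A * X) + d * 1 * Y) * X       ≡⟨ cong (λ z → (1 * z + d * 1 * Y) * X) [1+b+d]X≡[1+b]Y ⟩
    (1 * (suc b * Y) + d * 1 * Y) * X   ≡⟨ regroup b d X Y ⟩
    1 * (Y * (A * X))                   ∎
    where
    regroup : ∀ b d X Y → (1 * (suc b * Y) + d * 1 * Y) * X ≡ 1 * (Y * (suc (b + d) * X))
    regroup = solve-∀

1/C-recurrence : ∀ {m} b d → m ≡ b + d → 1/C m b ≡ 1/C (suc m) (suc b) +ℚ frac d (suc m) *ℚ 1/C m b
1/C-recurrence b d refl = reciprocal-split b d _ _
  (k≤n⇒nCk>0 (ℕ.m≤m+n b d)) (k≤n⇒nCk>0 (s≤s (ℕ.m≤m+n b d))) ([1+n]*nCk≡[1+k]*[1+n]C[1+k] (b + d) b)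

weight : ℕ → ℕ → ℕ → ℚ
weight n k t = frac (n ∸ k) (n ∸ t + 1)

1/C-step : ∀ {n k t} → k ≤ n → suc t < k →
  1/C (n ∸ suc t) (k ∸ suc t) ≡ 1/C (n ∸ t) (k ∸ t) +ℚ weight n k (suc t) *ℚ 1/C (n ∸ suc t) (k ∸ suc t)
1/C-step {n} {k} {t} k≤n t+1<k = begin
  1/C m b                                                  ≡⟨ 1/C-recurrence b (n ∸ k) m≡b+[n∸k] ⟩
  1/C (suc m) (suc b) +ℚ frac (n ∸ k) (suc m) *ℚ 1/C m b   ≡⟨ cong₂ (λ u v → u +ℚ frac (n ∸ k) v *ℚ 1/C m b)
                                                                    (cong₂ 1/C n∸t≡1+m k∸t≡1+b) (ℕ.+-comm m 1) ⟨
  1/C (n ∸ t) (k ∸ t) +ℚ frac (n ∸ k) (m + 1) *ℚ 1/C m b   ∎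
  where
  open ≡-Reasoning
  m b : ℕ
  m = n ∸ suc t
  b = k ∸ suc t
  t+1≤k : suc t ≤ k
  t+1≤k = ℕ.<⇒≤ t+1<k
  n∸t≡1+m : n ∸ t ≡ suc m
  n∸t≡1+m = ℕ.+-∸-assoc 1 (ℕ.≤-trans t+1≤k k≤n)
  k∸t≡1+b : k ∸ t ≡ suc b
  k∸t≡1+b = ℕ.+-∸-assoc 1 t+1≤k
  m≡b+[n∸k] : m ≡ b + (n ∸ k)
  m≡b+[n∸k] = trans (cong (_∸ suc t) (sym (ℕ.m+[n∸m]≡n k≤n))) (ℕ.+-∸-comm (n ∸ k) t+1≤k)

∑-++ : (xs ys : List ℚ) → ∑ (xs ++ ys) ≡ ∑ xs +ℚ ∑ ys
∑-++ []       ys = sym (ℚ.+-identityˡ (∑ ys))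
∑-++ (x ∷ xs) ys = trans (cong (x +ℚ_) (∑-++ xs ys)) (sym (ℚ.+-assoc x (∑ xs) (∑ ys)))

module _ {A : Set} where

  ∑-zero : (xs : List A) → ∑ (map (λ _ → 0ℚ) xs) ≡ 0ℚ
  ∑-zero []       = refl
  ∑-zero (x ∷ xs) = trans (ℚ.+-identityˡ _) (∑-zero xs)

  ∑-map-+ : (f g : A → ℚ) (xs : List A) → ∑ (map (λ x → f x +ℚ g x) xs) ≡ ∑ (map f xs) +ℚ ∑ (map g xs)
  ∑-map-+ f g []       = sym (ℚ.+-identityˡ 0ℚ)
  ∑-map-+ f g (x ∷ xs) = trans (cong ((f x +ℚ g x) +ℚ_) (∑-map-+ f g xs))
                               (interchange (f x) (g x) (∑ (map f xs)) (∑ (map g xs)))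

  ∑-map-*ˡ : (q : ℚ) (f : A → ℚ) (xs : List A) → ∑ (map (λ x → q *ℚ f x) xs) ≡ q *ℚ ∑ (map f xs)
  ∑-map-*ˡ q f []       = sym (ℚ.*-zeroʳ q)
  ∑-map-*ˡ q f (x ∷ xs) = trans (cong (q *ℚ f x +ℚ_) (∑-map-*ˡ q f xs)) (sym (ℚ.*-distribˡ-+ q (f x) _))

  ∑-const : (d : ℕ) (xs : List A) → ∑ (map (λ _ → frac 1 d) xs) ≡ frac (length xs) d
  ∑-const d []       = sym (frac-zero d)
  ∑-const d (x ∷ xs) = trans (cong (frac 1 d +ℚ_) (∑-const d xs)) (sym (frac-suc (length xs) d))

  ∑-mono-≤ : {f g : A → ℚ} {xs : List A} → All (λ x → f x ≤ℚ g x) xs → ∑ (map f xs) ≤ℚ ∑ (map g xs)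
  ∑-mono-≤ All.[]         = ℚ.≤-refl
  ∑-mono-≤ (fx≤gx All.∷ h) = ℚ.+-mono-≤ fx≤gx (∑-mono-≤ h)

  ∑-filter : ∀ {p} {P : Pred A p} (P? : Decidable P) (f : A → ℚ) (xs : List A) →
             ∑ (map f (filter P? xs)) ≡ ∑ (map (λ x → if does (P? x) then f x else 0ℚ) xs)
  ∑-filter P? f []       = refl
  ∑-filter P? f (x ∷ xs) with does (P? x)
  ... | true  = cong (f x +ℚ_) (∑-filter P? f xs)
  ... | false = trans (∑-filter P? f xs) (sym (ℚ.+-identityˡ _))

∑-swap : ∀ {A B : Set} (f : A → B → ℚ) (as : List A) (bs : List B) →
         ∑ (map (λ a → ∑ (map (f a) bs)) as) ≡ ∑ (map (λ b → ∑ (map (λ a → f a b) as)) bs)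
∑-swap f []       bs = sym (∑-zero bs)
∑-swap f (a ∷ as) bs = trans (cong (∑ (map (f a) bs) +ℚ_) (∑-swap f as bs))
                             (sym (∑-map-+ (f a) (λ b → ∑ (map (λ a → f a b) as)) bs))

∑-double-count : ∀ {A B : Set} {R : A → B → Set} (R? : ∀ a b → Dec (R a b)) (g : B → ℚ) (as : List A) (bs : List B) →
  ∑ (map (λ a → ∑ (map g (filter (R? a) bs))) as) ≡ ∑ (map (λ b → ∑ (map (λ _ → g b) (filter (λ a → R? a b) as))) bs)
∑-double-count R? g as bs = begin
  ∑ (map (λ a → ∑ (map g (filter (R? a) bs))) as)
    ≡⟨ cong ∑ (List.map-cong (λ a → ∑-filter (R? a) g bs) as) ⟩
  ∑ (map (λ a → ∑ (map (λ b → if does (R? a b) then g b else 0ℚ) bs)) as)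
    ≡⟨ ∑-swap (λ a b → if does (R? a b) then g b else 0ℚ) as bs ⟩
  ∑ (map (λ b → ∑ (map (λ a → if does (R? a b) then g b else 0ℚ) as)) bs)
    ≡⟨ cong ∑ (List.map-cong (λ b → ∑-filter (λ a → R? a b) (λ _ → g b) as) bs) ⟨
  ∑ (map (λ b → ∑ (map (λ _ → g b) (filter (λ a → R? a b) as))) bs) ∎
  where open ≡-Reasoning

applyUpTo-cong : ∀ {A : Set} {f g : ℕ → A} → (∀ i → f i ≡ g i) → ∀ m → applyUpTo f m ≡ applyUpTo g m
applyUpTo-cong f≗g zero    = refl
applyUpTo-cong f≗g (suc m) = cong₂ _∷_ (f≗g 0) (applyUpTo-cong (f≗g ∘ suc) m)

-- Defs.range recurses through a local helper, so it is only reachable through these two equations.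
range-unfold : ∀ {a b} → a ≤ b → range a b ≡ a ∷ range (suc a) b
range-unfold a≤b rewrite ℕ.+-∸-assoc 1 a≤b = refl

range-empty : ∀ {a b} → b < a → range a b ≡ []
range-empty b<a rewrite ℕ.m≤n⇒m∸n≡0 b<a = refl

range≡applyUpTo : ∀ a m → range (suc a) (a + m) ≡ applyUpTo (λ i → suc (a + i)) m
range≡applyUpTo a zero    = range-empty (s≤s (ℕ.≤-reflexive (ℕ.+-identityʳ a)))
range≡applyUpTo a (suc m) = begin
  range (suc a) (a + suc m)                    ≡⟨ range-unfold (ℕ.m<m+n a (s≤s z≤n)) ⟩
  suc a ∷ range (suc (suc a)) (a + suc m)      ≡⟨ cong (λ b → suc a ∷ range (suc (suc a)) b) (ℕ.+-suc a m) ⟩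
  suc a ∷ range (suc (suc a)) (suc a + m)      ≡⟨ cong (suc a ∷_) (range≡applyUpTo (suc a) m) ⟩
  suc a ∷ applyUpTo (λ i → suc (suc a + i)) m  ≡⟨ cong₂ _∷_ (cong suc (ℕ.+-identityʳ a))
                                                         (applyUpTo-cong (λ i → cong suc (ℕ.+-suc a i)) m) ⟨
  applyUpTo (λ i → suc (a + i)) (suc m)        ∎
  where open ≡-Reasoning

range-1≡applyUpTo-suc : ∀ m → range 1 m ≡ applyUpTo suc m
range-1≡applyUpTo-suc = range≡applyUpTo 0

filter-≤-applyUpTo-suc : ∀ {i m} → i ≤ m → filter (_≤? i) (applyUpTo suc m) ≡ applyUpTo suc i
filter-≤-applyUpTo-suc {i} {m} i≤m with ℕ.m≤n⇒m<n∨m≡n i≤m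
filter-≤-applyUpTo-suc {i} {.i}    _ | inj₂ refl     = List.filter-all (_≤? i) (All.applyUpTo⁺₁ suc i (λ j<i → j<i))
filter-≤-applyUpTo-suc {i} {suc m} _ | inj₁ (s≤s i≤m) = begin
  filter (_≤? i) (applyUpTo suc (suc m))
    ≡⟨ cong (filter (_≤? i)) (List.applyUpTo-∷ʳ suc m) ⟨
  filter (_≤? i) (applyUpTo suc m ∷ʳ suc m)
    ≡⟨ List.filter-++ (_≤? i) (applyUpTo suc m) [ suc m ] ⟩
  filter (_≤? i) (applyUpTo suc m) ++ filter (_≤? i) [ suc m ]
    ≡⟨ cong₂ _++_ (filter-≤-applyUpTo-suc i≤m) (List.filter-reject (_≤? i) (ℕ.<⇒≱ (s≤s i≤m))) ⟩
  applyUpTo suc i ++ []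
    ≡⟨ List.++-identityʳ (applyUpTo suc i) ⟩
  applyUpTo suc i ∎
  where open ≡-Reasoning

telescope : ∀ (f c : ℕ → ℚ) i → (∀ {t} → t < i → f (suc t) ≡ f t +ℚ c (suc t)) →
            f i ≡ f 0 +ℚ ∑ (map c (applyUpTo suc i))
telescope f c zero    _    = sym (ℚ.+-identityʳ (f 0))
telescope f c (suc i) step = begin
  f (suc i)                                                ≡⟨ step (ℕ.n<1+n i) ⟩
  f i +ℚ c (suc i)                                         ≡⟨ cong (_+ℚ c (suc i)) (telescope f c i (step ∘ ℕ.m<n⇒m<1+n)) ⟩
  (f 0 +ℚ ∑ (map c (applyUpTo suc i))) +ℚ c (suc i)        ≡⟨ ℚ.+-assoc (f 0) _ _ ⟩
  f 0 +ℚ (∑ (map c (applyUpTo suc i)) +ℚ c (suc i))        ≡⟨ cong (f 0 +ℚ_) last-term ⟨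
  f 0 +ℚ ∑ (map c (applyUpTo suc (suc i)))                 ∎
  where
  open ≡-Reasoning
  last-term : ∑ (map c (applyUpTo suc (suc i))) ≡ ∑ (map c (applyUpTo suc i)) +ℚ c (suc i)
  last-term = begin
    ∑ (map c (applyUpTo suc (suc i)))                ≡⟨ cong (∑ ∘ map c) (List.applyUpTo-∷ʳ suc i) ⟨
    ∑ (map c (applyUpTo suc i ∷ʳ suc i))             ≡⟨ cong ∑ (List.map-++ c (applyUpTo suc i) [ suc i ]) ⟩
    ∑ (map c (applyUpTo suc i) ++ [ c (suc i) ])     ≡⟨ ∑-++ (map c (applyUpTo suc i)) [ c (suc i) ] ⟩
    ∑ (map c (applyUpTo suc i)) +ℚ (c (suc i) +ℚ 0ℚ) ≡⟨ cong (∑ (map c (applyUpTo suc i)) +ℚ_) (ℚ.+-identityʳ (c (suc i))) ⟩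
    ∑ (map c (applyUpTo suc i)) +ℚ c (suc i)         ∎

iF≤∣A∩B∣ : ∀ {n} (F : List (Subset n)) A {B} → B ∈ F → iF F A ≤ ∣ A ∩ B ∣
iF≤∣A∩B∣ (B ∷ [])     A (here refl) = ℕ.≤-refl
iF≤∣A∩B∣ (B ∷ _ ∷ _)  A (here refl) = ℕ.m⊓n≤m _ _
iF≤∣A∩B∣ (_ ∷ B′ ∷ F) A (there B∈) = ℕ.≤-trans (ℕ.m⊓n≤n _ _) (iF≤∣A∩B∣ (B′ ∷ F) A B∈)

iF<∣A∣ : ∀ {n} (F : List (Subset n)) {A x} → x ∈ₛ A → (∃ λ B → B ∈ F × x ∉ₛ B) → iF F A < ∣ A ∣
iF<∣A∣ F {A} {x} x∈A (B , B∈F , x∉B) = ℕ.≤-<-trans (iF≤∣A∩B∣ F A B∈F)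
  (p⊂q⇒∣p∣<∣q∣ (p∩q⊆p A B , x , x∈A , λ x∈A∩B → x∉B (proj₂ (x∈p∩q⁻ A B x∈A∩B))))

∣p∣>0⇒Nonempty : ∀ {n} (p : Subset n) → 0 < ∣ p ∣ → Nonempty p
∣p∣>0⇒Nonempty {n} p ∣p∣>0 with nonempty? p
... | yes ne = ne
... | no ¬ne = contradiction (trans (cong ∣_∣ (Empty-unique ¬ne)) (∣⊥∣≡0 n)) (ℕ.>⇒≢ ∣p∣>0)

1/C-telescoped : ∀ {n k i} → k ≤ n → i < k →
  1/C (n ∸ i) (k ∸ i) ≡ 1/C n k +ℚ ∑ (map (λ t → weight n k t *ℚ 1/C (n ∸ t) (k ∸ t)) (filter (_≤? i) (range 1 (k ∸ 1))))
1/C-telescoped {n} {k} {i} k≤n i<k = begin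
  1/C (n ∸ i) (k ∸ i)                                   ≡⟨ telescope (λ t → 1/C (n ∸ t) (k ∸ t)) c i
                                                                      (λ t<i → 1/C-step k≤n (ℕ.≤-<-trans t<i i<k)) ⟩
  1/C n k +ℚ ∑ (map c (applyUpTo suc i))                ≡⟨ cong (λ ts → 1/C n k +ℚ ∑ (map c ts)) levels≤i ⟨
  1/C n k +ℚ ∑ (map c (filter (_≤? i) (range 1 (k ∸ 1)))) ∎
  where
  open ≡-Reasoning
  c : ℕ → ℚ
  c t = weight n k t *ℚ 1/C (n ∸ t) (k ∸ t)
  levels≤i : filter (_≤? i) (range 1 (k ∸ 1)) ≡ applyUpTo suc i
  levels≤i = trans (cong (filter (_≤? i)) (range-1≡applyUpTo-suc (k ∸ 1))) (filter-≤-applyUpTo-suc (ℕ.∸-monoˡ-≤ 1 i<k))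

Φ≡weighted-level-sum : ∀ {n k} (F : List (Subset n)) → All (λ A → ∣ A ∣ ≡ k) F → All (λ A → iF F A < k) F →
  Φ n k F ≡ frac (length F) (n C k)
            +ℚ ∑ (map (λ t → weight n k t *ℚ frac (length (G F t)) ((n ∸ t) C (k ∸ t))) (range 1 (k ∸ 1)))
Φ≡weighted-level-sum {n} {k} F uniform below = begin
  Φ n k F
    ≡⟨ cong ∑ (List.map-cong-local (All.zipWith telescoped (uniform , below))) ⟩
  ∑ (map (λ A → 1/C n k +ℚ ∑ (map c (filter (_≤? iF F A) T))) F)
    ≡⟨ ∑-map-+ (λ _ → 1/C n k) (λ A → ∑ (map c (filter (_≤? iF F A) T))) F ⟩
  ∑ (map (λ _ → 1/C n k) F) +ℚ ∑ (map (λ A → ∑ (map c (filter (_≤? iF F A) T))) F)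
    ≡⟨ cong₂ _+ℚ_ (∑-const (n C k) F) (∑-double-count (λ A t → t ≤? iF F A) c F T) ⟩
  frac (length F) (n C k) +ℚ ∑ (map (λ t → ∑ (map (λ _ → c t) (G F t))) T)
    ≡⟨ cong (frac (length F) (n C k) +ℚ_) (cong ∑ (List.map-cong level-count T)) ⟩
  frac (length F) (n C k) +ℚ ∑ (map (λ t → weight n k t *ℚ frac (length (G F t)) ((n ∸ t) C (k ∸ t))) T) ∎
  where
  open ≡-Reasoning
  T : List ℕ
  T = range 1 (k ∸ 1)
  c : ℕ → ℚ
  c t = weight n k t *ℚ 1/C (n ∸ t) (k ∸ t)
  telescoped : ∀ {A} → ∣ A ∣ ≡ k × iF F A < k → 1/C (n ∸ iF F A) (k ∸ iF F A) ≡ 1/C n k +ℚ ∑ (map c (filter (_≤? iF F A) T))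
  telescoped {A} (∣A∣≡k , i<k) = 1/C-telescoped (subst (_≤ n) ∣A∣≡k (∣p∣≤n A)) i<k
  level-count : ∀ t → ∑ (map (λ _ → c t) (G F t)) ≡ weight n k t *ℚ frac (length (G F t)) ((n ∸ t) C (k ∸ t))
  level-count t = trans (∑-map-*ˡ (weight n k t) (λ _ → 1/C (n ∸ t) (k ∸ t)) (G F t))
                        (cong (weight n k t *ℚ_) (∑-const ((n ∸ t) C (k ∸ t)) (G F t)))

p≤1⇒p*q≤q : ∀ {p} q → .{{NonNegative q}} → p ≤ℚ 1ℚ → p *ℚ q ≤ℚ q
p≤1⇒p*q≤q q p≤1 = ℚ.≤-trans (ℚ.*-monoʳ-≤-nonNeg q p≤1) (ℚ.≤-reflexive (ℚ.*-identityˡ q))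

weighted-level-sum≤level-sum : ∀ n k (g : ℕ → ℕ) →
  ∑ (map (λ t → weight n k t *ℚ frac (g t) ((n ∸ t) C (k ∸ t))) (range 1 (k ∸ 1)))
    ≤ℚ ∑ (map (λ t → frac (g t) ((n ∸ t) C (k ∸ t))) (range 1 (k ∸ 1)))
weighted-level-sum≤level-sum n k g rewrite range-1≡applyUpTo-suc (k ∸ 1) =
  ∑-mono-≤ (All.applyUpTo⁺₁ suc (k ∸ 1) (λ i<k-1 → term≤ (ℕ.≤-trans i<k-1 (ℕ.m∸n≤m k 1))))
  where
  term≤ : ∀ {t} → t ≤ k → weight n k t *ℚ frac (g t) ((n ∸ t) C (k ∸ t)) ≤ℚ frac (g t) ((n ∸ t) C (k ∸ t))
  term≤ {t} t≤k = p≤1⇒p*q≤q _ {{frac-nonNeg (g t) ((n ∸ t) C (k ∸ t))}} (frac≤1 (ℕ.≤-trans (ℕ.∸-monoʳ-≤ n t≤k) (ℕ.m≤m+n (n ∸ t) 1)))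

Φ≤level-sum : ∀ {n k} (F : List (Subset n)) → All (λ A → ∣ A ∣ ≡ k) F → All (λ A → iF F A < k) F →
  Φ n k F ≤ℚ frac (length F) (n C k) +ℚ ∑ (map (λ t → frac (length (G F t)) ((n ∸ t) C (k ∸ t))) (range 1 (k ∸ 1)))
Φ≤level-sum {n} {k} F uniform below =
  ℚ.≤-trans (ℚ.≤-reflexive (Φ≡weighted-level-sum F uniform below))
            (ℚ.+-monoʳ-≤ (frac (length F) (n C k)) (weighted-level-sum≤level-sum n k (length ∘ G F)))

lemma2p2 : (n k : ℕ) → k ≥ 1 → (F : List (Subset n)) → Unique F →
    All (λ A → ∣ A ∣ ≡ k) F →
    (∀ (x : Fin n) → ∃ λ A → A ∈ F × x ∉ₛ A) →
    (Φ n k F ≡ frac (length F) (n C k)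
        +ℚ ∑ (map (λ t → frac (n ∸ k) (n ∸ t + 1) *ℚ frac (length (G F t)) ((n ∸ t) C (k ∸ t))) (range 1 (k ∸ 1))))
    × (Φ n k F ≤ℚ frac (length F) (n C k)
        +ℚ ∑ (map (λ t → frac (length (G F t)) ((n ∸ t) C (k ∸ t))) (range 1 (k ∸ 1))))
lemma2p2 n k k≥1 F _ uniform cover = Φ≡weighted-level-sum F uniform below , Φ≤level-sum F uniform below
  where
  iF<k : ∀ {A} → A ∈ F → iF F A < k
  iF<k {A} A∈F with ∣p∣>0⇒Nonempty A (subst (0 <_) (sym (All.lookup uniform A∈F)) k≥1)
  ... | x , x∈A = subst (iF F A <_) (All.lookup uniform A∈F) (iF<∣A∣ F x∈A (cover x))
  below : All (λ A → iF F A < k) F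
  below = All.tabulate iF<k
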